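{- Let $G_i=(V,E_i)$, $i=1,\dots,t$, be graphs on a common vertex set, let $G_\cap=\bigcap_{i=1}^tG_i=(V,\bigcap_{i=1}^tE_i)$, let $c>0$, let $C$ be a clique in $G_\cap$, and let $C'\subseteq C$ be such that $(C',[1,t])$ is a vertex-maximal usually-avg-$c$-isolated temporal clique. Let $\tilde C\subseteq C$ consist of the $\delta_{G_\cap}(C)-c+2$ vertices $v$ of $C$ with the lowest values of $\sum_{i=1}^t\deg_{G_i}(v)$. Then $\tilde C\subseteq C'$.
   Context: Graphs are simple and undirected; $\delta_G(C)=\min_{v\in C}\deg_G(v)$. The $G_i$ are viewed as the layers of the temporal graph $(V,E_1,\dots,E_t)$. A temporal clique is a pair $(X,[a,b])$ with $X\subseteq V$, $1\le a\le b\le t$, such that $X$ is a clique in every $G_i$, $i\in[a,b]$. For $v\in A\subseteq V$, $\mathrm{outdeg}_{G}(v,A)$ is the number of edges of $G$ with one endpoint $v$ and the other outside $A$. A temporal clique $(X,[a,b])$ is usually-avg-$c$-isolated if $\sum_{i=a}^b\sum_{v\in X}\mathrm{outdeg}_{G_i}(v,X)<c|X|(b+1-a)$. A usually-avg-$c$-isolated temporal clique $(X,[a,b])$ is vertex-maximal if there is no usually-avg-$c$-isolated temporal clique $(X',[a,b])$ with $X'\supsetneq X$. -}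

module Defs where

open import Data.Nat using (ℕ; zero; suc; _+_; _*_; _∸_; _≤_; _<_; _≤ᵇ_)
open import Data.Bool using (Bool; true; false; _∧_; not; if_then_else_)
open import Data.Fin using (Fin; toℕ)
open import Data.Fin.Subset using (Subset; _∈_; _∉_; _⊆_; _⊂_; ∣_∣)
open import Data.Vec using (lookup; tabulate)
open import Data.Product using (_×_; Σ; ∃)
open import Relation.Binary.PropositionalEquality using (_≡_; _≢_)
open import Relation.Nullary using (¬_)

Adj : ℕ → Set
Adj n = Fin n → Fin n → Bool

record SimpleGraph (n : ℕ) : Set where
  field
    adj    : Adj n
    sym    : ∀ u v → adj u v ≡ adj v u
    irrefl : ∀ v → adj v v ≡ false
open SimpleGraph public

sumFin : ∀ {m} → (Fin m → ℕ) → ℕ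
sumFin {zero}  f = 0
sumFin {suc m} f = f Data.Fin.zero + sumFin {m} (λ i → f (Data.Fin.suc i))

andFin : ∀ {m} → (Fin m → Bool) → Bool
andFin {zero}  f = true
andFin {suc m} f = f Data.Fin.zero ∧ andFin {m} (λ i → f (Data.Fin.suc i))

deg : ∀ {n} → Adj n → Fin n → ℕ
deg A v = ∣ tabulate (A v) ∣

outdeg : ∀ {n} → Adj n → Fin n → Subset n → ℕ
outdeg A v X = ∣ tabulate (λ u → A v u ∧ not (lookup X u)) ∣

interAdj : ∀ {n t} → (Fin t → SimpleGraph n) → Adj n
interAdj G u v = andFin (λ i → adj (G i) u v)

IsClique : ∀ {n} → Adj n → Subset n → Set
IsClique A X = ∀ u v → u ∈ X → v ∈ X → u ≢ v → A u v ≡ true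

IsMinDegree : ∀ {n} → Adj n → Subset n → ℕ → Set
IsMinDegree A C δ = (∃ λ v → v ∈ C × deg A v ≡ δ) × (∀ v → v ∈ C → δ ≤ deg A v)

-- Layers are indexed by Fin t (layer i : Fin t is G_{toℕ i + 1}).
-- Interval [a,b] of layers: a ≤ i ≤ b.
inIntv : ∀ {t} → Fin t → Fin t → Fin t → Bool
inIntv a b i = (toℕ a ≤ᵇ toℕ i) ∧ (toℕ i ≤ᵇ toℕ b)

TemporalClique : ∀ {n t} → (Fin t → SimpleGraph n) → Subset n → Fin t → Fin t → Set
TemporalClique G X a b =
  toℕ a ≤ toℕ b × (∀ i → toℕ a ≤ toℕ i → toℕ i ≤ toℕ b → IsClique (adj (G i)) X)

isoSum : ∀ {n t} → (Fin t → SimpleGraph n) → Subset n → Fin t → Fin t → ℕ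
isoSum G X a b =
  sumFin (λ i → if inIntv a b i
                then sumFin (λ v → if lookup X v then outdeg (adj (G i)) v X else 0)
                else 0)

UsuallyAvgIsolated : ∀ {n t} → ℕ → (Fin t → SimpleGraph n) → Subset n → Fin t → Fin t → Set
UsuallyAvgIsolated c G X a b =
  TemporalClique G X a b × isoSum G X a b < c * ∣ X ∣ * (suc (toℕ b) ∸ toℕ a)

VertexMaximal : ∀ {n t} → ℕ → (Fin t → SimpleGraph n) → Subset n → Fin t → Fin t → Set
VertexMaximal c G X a b =
  UsuallyAvgIsolated c G X a b × (∀ X' → X ⊂ X' → ¬ UsuallyAvgIsolated c G X' a b)

totDeg : ∀ {n t} → (Fin t → SimpleGraph n) → Fin n → ℕ
totDeg G v = sumFin (λ i → deg (adj (G i)) v)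

{-# OPTIONS --safe #-}
-- Suppose some x ∈ C~ is missing from C'. Every subset X of C is a clique in each of the T layers, so
-- its isolation sum is Σ_{v∈X} totDeg v − T|X|(|X| − 1), and X is usually-avg-c-isolated exactly when
-- Σ_{v∈X} totDeg v < T|X|(|X| + c − 1). Of the vertices of C', the a ones in C~ have total degree at
-- least Tδ, where a ≤ δ + 1 − c because x ∈ C~ ∖ C' and |C~| = δ + 2 − c; the b ones outside C~ have
-- total degree at least totDeg x, as C~ collects the lowest total degrees. These bounds show that
-- C' ∪ {x} still satisfies the inequality, contradicting the vertex-maximality of C'.
module Submission where

open import Defs hiding (sym)
open import Data.Bool using (Bool; true; false; _∧_; not; if_then_else_)
open import Data.Bool.Properties using (¬-not; T-≡)
open import Data.Fin using (Fin; zero; suc; toℕ; fromℕ; _≟_)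
open import Data.Fin.Properties using (toℕ-fromℕ; ≤fromℕ)
open import Data.Fin.Subset using (Subset; _∈_; _∉_; _⊆_; _⊂_; ∣_∣; _∩_; _∪_; ∁; ⁅_⁆)
open import Data.Fin.Subset.Properties
  using (_∈?_; ∣⁅x⁆∣≡1; x∈⁅x⁆; x∈⁅y⁆⇒x≡y; x≢y⇒x∉⁅y⁆; ∪-identityʳ; p⊆p∪q; q⊆p∪q;
         x∈p∪q⁻; p∩q⊆q; x∈p∩q⁻; x∈∁p⇒x∉p; p⊂q⇒∣p∣<∣q∣; drop-not-there)
open import Data.List using (List; []; _∷_)
open import Data.Nat using (ℕ; zero; suc; _+_; _*_; _∸_; _≤_; _<_; _≤ᵇ_; z≤n)
open import Data.Nat.Properties
  using (+-commutativeSemigroup; +-comm; +-assoc; *-zeroʳ; *-identityʳ; ≤-refl; ≤-trans; ≤-pred;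
         <⇒≤; _≤?_; ≰⇒>; <-irrefl; n≮0; ≤⇒≤ᵇ; m≤m+n; m≤o∸n⇒m+n≤o; m≤n⇒m∸n≡0; +-mono-≤; +-monoˡ-≤;
         +-monoʳ-≤; +-monoˡ-<; +-cancelʳ-<; *-monoʳ-≤; *-monoʳ-<; module ≤-Reasoning)
open import Algebra.Properties.CommutativeSemigroup +-commutativeSemigroup using (interchange; x∙yz≈y∙xz)
open import Data.Nat.Tactic.RingSolver using (solve)
open import Data.Product using (_,_; proj₁; proj₂)
open import Data.Sum using ([_,_])
open import Data.Vec using ([]; _∷_; here; there; lookup; tabulate)
open import Data.Vec.Properties using (lookup∘tabulate; []=⇒lookup; lookup⇒[]=)
open import Function using (_∘_; _∋_; _⇔_; mk⇔; Equivalence)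
open import Relation.Binary.PropositionalEquality
  using (_≡_; _≢_; refl; sym; trans; cong; cong₂; subst; subst₂; module ≡-Reasoning)
open import Relation.Nullary using (yes; no; contradiction)

sumFin-cong : ∀ {m} {f g : Fin m → ℕ} → (∀ i → f i ≡ g i) → sumFin f ≡ sumFin g
sumFin-cong {zero}  f≗g = refl
sumFin-cong {suc m} f≗g = cong₂ _+_ (f≗g zero) (sumFin-cong (f≗g ∘ suc))

sumFin-mono : ∀ {m} {f g : Fin m → ℕ} → (∀ i → f i ≤ g i) → sumFin f ≤ sumFin g
sumFin-mono {zero}  f≤g = z≤n
sumFin-mono {suc m} f≤g = +-mono-≤ (f≤g zero) (sumFin-mono (f≤g ∘ suc))

sumFin-distrib-+ : ∀ {m} (f g : Fin m → ℕ) → sumFin (λ i → f i + g i) ≡ sumFin f + sumFin g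
sumFin-distrib-+ {zero}  f g = refl
sumFin-distrib-+ {suc m} f g =
  trans (cong (f zero + g zero +_) (sumFin-distrib-+ (f ∘ suc) (g ∘ suc)))
        (interchange (f zero) (g zero) (sumFin (f ∘ suc)) (sumFin (g ∘ suc)))

sumFin-const : ∀ {m} k → sumFin {m} (λ _ → k) ≡ m * k
sumFin-const {zero}  k = refl
sumFin-const {suc m} k = cong (k +_) (sumFin-const {m} k)

sumFin-zero : ∀ m → sumFin {m} (λ _ → 0) ≡ 0
sumFin-zero m = trans (sumFin-const {m} 0) (*-zeroʳ m)

sumOver : ∀ {n} → Subset n → (Fin n → ℕ) → ℕ
sumOver X f = sumFin (λ v → if lookup X v then f v else 0)

sumOver-cong : ∀ {n} (X : Subset n) {f g : Fin n → ℕ} → (∀ {v} → v ∈ X → f v ≡ g v) →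
               sumOver X f ≡ sumOver X g
sumOver-cong []          f≗g = refl
sumOver-cong (true  ∷ X) f≗g = cong₂ _+_ (f≗g here) (sumOver-cong X (f≗g ∘ there))
sumOver-cong (false ∷ X) f≗g = sumOver-cong X (f≗g ∘ there)

sumOver-mono : ∀ {n} (X : Subset n) {f g : Fin n → ℕ} → (∀ {v} → v ∈ X → f v ≤ g v) →
               sumOver X f ≤ sumOver X g
sumOver-mono []          f≤g = z≤n
sumOver-mono (true  ∷ X) f≤g = +-mono-≤ (f≤g here) (sumOver-mono X (f≤g ∘ there))
sumOver-mono (false ∷ X) f≤g = sumOver-mono X (f≤g ∘ there)

sumOver-distrib-+ : ∀ {n} (X : Subset n) (f g : Fin n → ℕ) →
                    sumOver X (λ v → f v + g v) ≡ sumOver X f + sumOver X g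
sumOver-distrib-+ []          f g = refl
sumOver-distrib-+ (true  ∷ X) f g =
  trans (cong (f zero + g zero +_) (sumOver-distrib-+ X (f ∘ suc) (g ∘ suc)))
        (interchange (f zero) (g zero) (sumOver X (f ∘ suc)) (sumOver X (g ∘ suc)))
sumOver-distrib-+ (false ∷ X) f g = sumOver-distrib-+ X (f ∘ suc) (g ∘ suc)

sumOver-const : ∀ {n} (X : Subset n) k → sumOver X (λ _ → k) ≡ ∣ X ∣ * k
sumOver-const []          k = refl
sumOver-const (true  ∷ X) k = cong (k +_) (sumOver-const X k)
sumOver-const (false ∷ X) k = sumOver-const X k

sumOver-count : ∀ {n} (X : Subset n) → sumOver X (λ _ → 1) ≡ ∣ X ∣
sumOver-count X = trans (sumOver-const X 1) (*-identityʳ ∣ X ∣)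

sumOver-sumFin-comm : ∀ {n m} (X : Subset n) (f : Fin m → Fin n → ℕ) →
                      sumOver X (λ v → sumFin (λ i → f i v)) ≡ sumFin (λ i → sumOver X (f i))
sumOver-sumFin-comm {m = m} [] f = sym (sumFin-zero m)
sumOver-sumFin-comm (true  ∷ X) f =
  trans (cong (sumFin (λ i → f i zero) +_) (sumOver-sumFin-comm X (λ i → f i ∘ suc)))
        (sym (sumFin-distrib-+ (λ i → f i zero) (λ i → sumOver X (f i ∘ suc))))
sumOver-sumFin-comm (false ∷ X) f = sumOver-sumFin-comm X (λ i → f i ∘ suc)

sumOver-∩-∁ : ∀ {n} (X Y : Subset n) (f : Fin n → ℕ) →
              sumOver X f ≡ sumOver (X ∩ Y) f + sumOver (X ∩ ∁ Y) f
sumOver-∩-∁ []          []          f = refl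
sumOver-∩-∁ (true  ∷ X) (true  ∷ Y) f =
  trans (cong (f zero +_) (sumOver-∩-∁ X Y (f ∘ suc)))
        (sym (+-assoc (f zero) (sumOver (X ∩ Y) (f ∘ suc)) (sumOver (X ∩ ∁ Y) (f ∘ suc))))
sumOver-∩-∁ (true  ∷ X) (false ∷ Y) f =
  trans (cong (f zero +_) (sumOver-∩-∁ X Y (f ∘ suc)))
        (x∙yz≈y∙xz (f zero) (sumOver (X ∩ Y) (f ∘ suc)) (sumOver (X ∩ ∁ Y) (f ∘ suc)))
sumOver-∩-∁ (false ∷ X) (_     ∷ Y) f = sumOver-∩-∁ X Y (f ∘ suc)

sumOver-∪-⁅⁆ : ∀ {n} (X : Subset n) {x} (f : Fin n → ℕ) → x ∉ X →
               sumOver (X ∪ ⁅ x ⁆) f ≡ sumOver X f + f x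
sumOver-∪-⁅⁆ (true  ∷ X) {zero}  f x∉X = contradiction here x∉X
sumOver-∪-⁅⁆ (false ∷ X) {zero}  f x∉X =
  trans (cong (λ Y → f zero + sumOver Y (f ∘ suc)) (∪-identityʳ X))
        (+-comm (f zero) (sumOver X (f ∘ suc)))
sumOver-∪-⁅⁆ (true  ∷ X) {suc x} f x∉X =
  trans (cong (f zero +_) (sumOver-∪-⁅⁆ X (f ∘ suc) (drop-not-there x∉X)))
        (sym (+-assoc (f zero) (sumOver X (f ∘ suc)) (f (suc x))))
sumOver-∪-⁅⁆ (false ∷ X) {suc x} f x∉X = sumOver-∪-⁅⁆ X (f ∘ suc) (drop-not-there x∉X)

∣p∣≡∣p∩q∣+∣p∩∁q∣ : ∀ {n} (p q : Subset n) → ∣ p ∣ ≡ ∣ p ∩ q ∣ + ∣ p ∩ ∁ q ∣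
∣p∣≡∣p∩q∣+∣p∩∁q∣ p q = begin
  ∣ p ∣                                                   ≡⟨ sumOver-count p ⟨
  sumOver p (λ _ → 1)                                     ≡⟨ sumOver-∩-∁ p q (λ _ → 1) ⟩
  sumOver (p ∩ q) (λ _ → 1) + sumOver (p ∩ ∁ q) (λ _ → 1)
    ≡⟨ cong₂ _+_ (sumOver-count (p ∩ q)) (sumOver-count (p ∩ ∁ q)) ⟩
  ∣ p ∩ q ∣ + ∣ p ∩ ∁ q ∣                                 ∎
  where open ≡-Reasoning

sumOver≥-∩-∁ : ∀ {n} (X Y : Subset n) {f : Fin n → ℕ} {A B : ℕ} →
               (∀ {w} → w ∈ X ∩ Y → A ≤ f w) → (∀ {w} → w ∈ X ∩ ∁ Y → B ≤ f w) →
               ∣ X ∩ Y ∣ * A + ∣ X ∩ ∁ Y ∣ * B ≤ sumOver X f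
sumOver≥-∩-∁ X Y {f} {A} {B} A≤f B≤f = begin
  ∣ X ∩ Y ∣ * A + ∣ X ∩ ∁ Y ∣ * B
    ≡⟨ cong₂ _+_ (sumOver-const (X ∩ Y) A) (sumOver-const (X ∩ ∁ Y) B) ⟨
  sumOver (X ∩ Y) (λ _ → A) + sumOver (X ∩ ∁ Y) (λ _ → B)
    ≤⟨ +-mono-≤ (sumOver-mono (X ∩ Y) A≤f) (sumOver-mono (X ∩ ∁ Y) B≤f) ⟩
  sumOver (X ∩ Y) f + sumOver (X ∩ ∁ Y) f
    ≡⟨ sumOver-∩-∁ X Y f ⟨
  sumOver X f ∎
  where open ≤-Reasoning

x∉p⇒∣p∪⁅x⁆∣≡1+∣p∣ : ∀ {n} (p : Subset n) {x} → x ∉ p → ∣ p ∪ ⁅ x ⁆ ∣ ≡ suc ∣ p ∣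
x∉p⇒∣p∪⁅x⁆∣≡1+∣p∣ p {x} x∉p = begin
  ∣ p ∪ ⁅ x ⁆ ∣                ≡⟨ sumOver-count (p ∪ ⁅ x ⁆) ⟨
  sumOver (p ∪ ⁅ x ⁆) (λ _ → 1) ≡⟨ sumOver-∪-⁅⁆ p (λ _ → 1) x∉p ⟩
  sumOver p (λ _ → 1) + 1       ≡⟨ cong (_+ 1) (sumOver-count p) ⟩
  ∣ p ∣ + 1                     ≡⟨ +-comm ∣ p ∣ 1 ⟩
  suc ∣ p ∣                     ∎
  where open ≡-Reasoning

indicator : Bool → ℕ
indicator b = if b then 1 else 0

count : ∀ {m} → (Fin m → Bool) → ℕ
count p = sumFin (indicator ∘ p)

∣tabulate∣≡count : ∀ {m} (p : Fin m → Bool) → ∣ tabulate p ∣ ≡ count p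
∣tabulate∣≡count p = trans (sym (sumOver-count (tabulate p)))
  (sumFin-cong (cong indicator ∘ lookup∘tabulate p))

count-mono : ∀ {m} {p q : Fin m → Bool} → (∀ i → p i ≡ true → q i ≡ true) → count p ≤ count q
count-mono {p = p} {q} p⇒q = sumFin-mono pointwise
  where
  pointwise : ∀ i → indicator (p i) ≤ indicator (q i)
  pointwise i with p i in pᵢ
  ... | false = z≤n
  ... | true rewrite p⇒q i pᵢ = ≤-refl

andFin≡true⇒ : ∀ {m} {f : Fin m → Bool} → andFin f ≡ true → ∀ i → f i ≡ true
andFin≡true⇒ {suc m} {f} all zero with f zero | all
... | true | _ = refl
andFin≡true⇒ {suc m} {f} all (suc i) with f zero | all
... | true | rest = andFin≡true⇒ rest i

clique-⊆ : ∀ {n} {A : Adj n} {X Y : Subset n} → IsClique A X → Y ⊆ X → IsClique A Y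
clique-⊆ X-clique Y⊆X u v u∈Y v∈Y = X-clique u v (Y⊆X u∈Y) (Y⊆X v∈Y)

interAdj-clique⇒ : ∀ {n t} (G : Fin t → SimpleGraph n) {X : Subset n} →
                   IsClique (interAdj G) X → ∀ i → IsClique (adj (G i)) X
interAdj-clique⇒ G X-clique i u v u∈X v∈X u≢v = andFin≡true⇒ (X-clique u v u∈X v∈X u≢v) i

deg-interAdj≤deg : ∀ {n t} (G : Fin t → SimpleGraph n) i v → deg (interAdj G) v ≤ deg (adj (G i)) v
deg-interAdj≤deg G i v =
  subst₂ _≤_ (sym (∣tabulate∣≡count (interAdj G v))) (sym (∣tabulate∣≡count (adj (G i) v)))
  (count-mono (λ u both → andFin≡true⇒ {f = λ j → adj (G j) v u} both i))

t*deg-interAdj≤totDeg : ∀ {n t} (G : Fin t → SimpleGraph n) v → t * deg (interAdj G) v ≤ totDeg G v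
t*deg-interAdj≤totDeg {t = t} G v =
  subst (_≤ totDeg G v) (sumFin-const {t} _) (sumFin-mono (λ i → deg-interAdj≤deg G i v))

minDegree⇒t*δ≤totDeg : ∀ {n t} (G : Fin t → SimpleGraph n) {C : Subset n} {δ : ℕ} →
                        IsMinDegree (interAdj G) C δ → ∀ {v} → v ∈ C → t * δ ≤ totDeg G v
minDegree⇒t*δ≤totDeg {t = t} G (_ , δ≤deg) {v} v∈C =
  ≤-trans (*-monoʳ-≤ t (δ≤deg v v∈C)) (t*deg-interAdj≤totDeg G v)

lookup-⁅⁆-≢ : ∀ {n} {u v : Fin n} → u ≢ v → lookup ⁅ v ⁆ u ≡ false
lookup-⁅⁆-≢ {u = u} {v} u≢v = ¬-not (x≢y⇒x∉⁅y⁆ u≢v ∘ lookup⇒[]= u ⁅ v ⁆)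

deg+1≡outdeg+∣∣ : ∀ {n} (G : SimpleGraph n) {X : Subset n} → IsClique (adj G) X →
                  ∀ {v} → v ∈ X → deg (adj G) v + 1 ≡ outdeg (adj G) v X + ∣ X ∣
deg+1≡outdeg+∣∣ {n} G {X} X-clique {v} v∈X = begin
  deg (adj G) v + 1
    ≡⟨ cong₂ _+_ (∣tabulate∣≡count N) (sym (trans (sumOver-count ⁅ v ⁆) (∣⁅x⁆∣≡1 v))) ⟩
  count N + count (lookup ⁅ v ⁆)
    ≡⟨ sumFin-distrib-+ (indicator ∘ N) (indicator ∘ lookup ⁅ v ⁆) ⟨
  sumFin (λ u → indicator (N u) + indicator (lookup ⁅ v ⁆ u))
    ≡⟨ sumFin-cong pointwise ⟩
  sumFin (λ u → indicator (N u ∧ not (lookup X u)) + indicator (lookup X u))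
    ≡⟨ sumFin-distrib-+ (λ u → indicator (N u ∧ not (lookup X u))) (indicator ∘ lookup X) ⟩
  count (λ u → N u ∧ not (lookup X u)) + count (lookup X)
    ≡⟨ cong₂ _+_ (sym (∣tabulate∣≡count (λ u → N u ∧ not (lookup X u)))) (sumOver-count X) ⟩
  outdeg (adj G) v X + ∣ X ∣ ∎
  where
  open ≡-Reasoning
  N : Fin n → Bool
  N = adj G v
  -- v is in X but not in N, and every other vertex of X is in N.
  pointwise : ∀ u → indicator (N u) + indicator (lookup ⁅ v ⁆ u)
                  ≡ indicator (N u ∧ not (lookup X u)) + indicator (lookup X u)
  pointwise u with u ≟ v
  ... | yes refl rewrite irrefl G v | []=⇒lookup v∈X | []=⇒lookup (x∈⁅x⁆ v) = refl
  ... | no u≢v rewrite lookup-⁅⁆-≢ u≢v with lookup X u in u∈X | N u in vu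
  ...   | true  | true  = refl
  ...   | true  | false =
    contradiction (trans (sym (X-clique v u v∈X (lookup⇒[]= u X u∈X) (u≢v ∘ sym))) vu) λ ()
  ...   | false | true  = refl
  ...   | false | false = refl

sumOver-outdeg-clique : ∀ {n} (G : SimpleGraph n) {X : Subset n} → IsClique (adj G) X →
  sumOver X (λ v → outdeg (adj G) v X) + ∣ X ∣ * ∣ X ∣ ≡ sumOver X (deg (adj G)) + ∣ X ∣
sumOver-outdeg-clique {n} G {X} X-clique = begin
  sumOver X out + ∣ X ∣ * ∣ X ∣                  ≡⟨ cong (sumOver X out +_) (sumOver-const X ∣ X ∣) ⟨
  sumOver X out + sumOver X (λ _ → ∣ X ∣)        ≡⟨ sumOver-distrib-+ X out (λ _ → ∣ X ∣) ⟨
  sumOver X (λ v → out v + ∣ X ∣)                ≡⟨ sumOver-cong X (sym ∘ deg+1≡outdeg+∣∣ G X-clique) ⟩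
  sumOver X (λ v → deg (adj G) v + 1)            ≡⟨ sumOver-distrib-+ X (deg (adj G)) (λ _ → 1) ⟩
  sumOver X (deg (adj G)) + sumOver X (λ _ → 1)  ≡⟨ cong (sumOver X (deg (adj G)) +_) (sumOver-count X) ⟩
  sumOver X (deg (adj G)) + ∣ X ∣                ∎
  where
  open ≡-Reasoning
  out : Fin n → ℕ
  out v = outdeg (adj G) v X

inIntv-full : ∀ {t} (i : Fin (suc t)) → inIntv zero (fromℕ t) i ≡ true
inIntv-full i = cong₂ _∧_ (≤ᵇ-true {0} {toℕ i} z≤n) (≤ᵇ-true (≤fromℕ i))
  where
  ≤ᵇ-true : ∀ {m n} → m ≤ n → (m ≤ᵇ n) ≡ true
  ≤ᵇ-true = Equivalence.to T-≡ ∘ ≤⇒≤ᵇ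

isoSum-clique : ∀ {n t} (G : Fin (suc t) → SimpleGraph n) {X : Subset n} →
  (∀ i → IsClique (adj (G i)) X) →
  isoSum G X zero (fromℕ t) + suc t * (∣ X ∣ * ∣ X ∣) ≡ sumOver X (totDeg G) + suc t * ∣ X ∣
isoSum-clique {t = t} G {X} X-clique = begin
  isoSum G X zero (fromℕ t) + suc t * (k * k)
    ≡⟨ cong₂ _+_ (sumFin-cong (λ i → cong (λ b → if b then out i else 0) (inIntv-full i)))
                 (sym (sumFin-const {suc t} (k * k))) ⟩
  sumFin out + sumFin {suc t} (λ _ → k * k)    ≡⟨ sumFin-distrib-+ out (λ _ → k * k) ⟨
  sumFin (λ i → out i + k * k)                 ≡⟨ sumFin-cong (λ i → sumOver-outdeg-clique (G i) (X-clique i)) ⟩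
  sumFin (λ i → degs i + k)                    ≡⟨ sumFin-distrib-+ degs (λ _ → k) ⟩
  sumFin degs + sumFin {suc t} (λ _ → k)
    ≡⟨ cong₂ _+_ (sumOver-sumFin-comm X (λ i → deg (adj (G i)))) (sym (sumFin-const {suc t} k)) ⟨
  sumOver X (totDeg G) + suc t * k             ∎
  where
  open ≡-Reasoning
  k : ℕ
  k = ∣ X ∣
  out degs : Fin (suc t) → ℕ
  out  i = sumOver X (λ v → outdeg (adj (G i)) v X)
  degs i = sumOver X (deg (adj (G i)))

m<n∸o⇒m+o<n : ∀ {m n o} → m < n ∸ o → m + o < n
m<n∸o⇒m+o<n {m} {n} {o} m<n∸o with o ≤? n
... | yes o≤n = m≤o∸n⇒m+n≤o (suc m) o≤n m<n∸o
... | no  o≰n = contradiction (subst (m <_) (m≤n⇒m∸n≡0 (<⇒≤ (≰⇒> o≰n))) m<n∸o) n≮0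

-- P < T m (m + c − 1), with the subtraction moved to the left.
DegreeSumBelow : (T c P m : ℕ) → Set
DegreeSumBelow T c P m = P + T * m < m * (T * (c + m))

isoSum<⇔DegreeSumBelow : ∀ {T c S P m} → S + T * (m * m) ≡ P + T * m →
                         S < c * m * T ⇔ DegreeSumBelow T c P m
isoSum<⇔DegreeSumBelow {T} {c} {S} {P} {m} S+Tm²≡P+Tm = mk⇔
  (λ S< → subst₂ _<_ S+Tm²≡P+Tm bound≡ (+-monoˡ-< (T * (m * m)) S<))
  (λ below → +-cancelʳ-< (T * (m * m)) S (c * m * T)
               (subst₂ _<_ (sym S+Tm²≡P+Tm) (sym bound≡) below))
  where
  bound≡ : c * m * T + T * (m * m) ≡ m * (T * (c + m))
  -- `List ℕ ∋` resolves the overloading of [] and _∷_ with the Vec constructors.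
  bound≡ = solve (List ℕ ∋ T ∷ c ∷ m ∷ [])

usuallyAvgIsolated⇔DegreeSumBelow :
  ∀ {n t} (G : Fin (suc t) → SimpleGraph n) (c : ℕ) {X : Subset n} →
  (∀ i → IsClique (adj (G i)) X) →
  UsuallyAvgIsolated c G X zero (fromℕ t) ⇔ DegreeSumBelow (suc t) c (sumOver X (totDeg G)) ∣ X ∣
usuallyAvgIsolated⇔DegreeSumBelow {t = t} G c {X} X-clique = mk⇔
  (λ (_ , isolated) → Equivalence.to iso⇔ (subst (isoSum< ∘ suc) (toℕ-fromℕ t) isolated))
  (λ below → (z≤n , λ i _ _ → X-clique i) ,
             subst (isoSum< ∘ suc) (sym (toℕ-fromℕ t)) (Equivalence.from iso⇔ below))
  where
  isoSum< : ℕ → Set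
  isoSum< T = isoSum G X zero (fromℕ t) < c * ∣ X ∣ * T
  iso⇔ : isoSum< (suc t) ⇔ DegreeSumBelow (suc t) c (sumOver X (totDeg G)) ∣ X ∣
  iso⇔ = isoSum<⇔DegreeSumBelow {suc t} {c} {P = sumOver X (totDeg G)} {∣ X ∣} (isoSum-clique G X-clique)

degreeSumBelow-insert : ∀ {T c δ a b P D} →
  DegreeSumBelow T c P (a + b) → a * (T * δ) + b * D ≤ P → a + c ≤ suc δ →
  DegreeSumBelow T c (P + D) (suc (a + b))
degreeSumBelow-insert {T} {c} {δ} {a} {b} {P} {D} below lower small = begin-strict
  P + D + T * suc (a + b)                              <⟨ +-monoˡ-< (T * suc (a + b)) P+D< ⟩
  suc (a + b) * (T * (c + (a + b))) + T * suc (a + b)  ≡⟨ solve (List ℕ ∋ T ∷ c ∷ a ∷ b ∷ []) ⟩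
  suc (a + b) * (T * (c + suc (a + b)))                ∎
  where
  open ≤-Reasoning
  bD+aR≤ : b * D + a * (T * (c + (a + b))) ≤ P + T * a * suc b
  bD+aR≤ = begin
    b * D + a * (T * (c + (a + b)))
      ≡⟨ solve (List ℕ ∋ T ∷ c ∷ a ∷ b ∷ D ∷ []) ⟩
    a * (T * (a + c)) + b * D + T * a * b
      ≤⟨ +-monoˡ-≤ (T * a * b) (+-monoˡ-≤ (b * D) (*-monoʳ-≤ a (*-monoʳ-≤ T small))) ⟩
    a * (T * suc δ) + b * D + T * a * b
      ≡⟨ solve (List ℕ ∋ T ∷ δ ∷ a ∷ b ∷ D ∷ []) ⟩
    a * (T * δ) + b * D + T * a * suc b
      ≤⟨ +-monoˡ-≤ (T * a * suc b) lower ⟩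
    P + T * a * suc b ∎
  -- Weighing a failure by b and the bound for C' by b + 1 makes them incompatible with bD+aR≤.
  P+D< : P + D < suc (a + b) * (T * (c + (a + b)))
  P+D< = ≰⇒> λ large → <-irrefl refl (begin-strict
    suc b * ((a + b) * (T * (c + (a + b))))
      ≡⟨ solve (List ℕ ∋ T ∷ c ∷ a ∷ b ∷ []) ⟩
    b * (suc (a + b) * (T * (c + (a + b)))) + a * (T * (c + (a + b)))
      ≤⟨ +-monoˡ-≤ (a * (T * (c + (a + b)))) (*-monoʳ-≤ b large) ⟩
    b * (P + D) + a * (T * (c + (a + b)))
      ≡⟨ solve (List ℕ ∋ T ∷ c ∷ a ∷ b ∷ P ∷ D ∷ []) ⟩
    b * P + (b * D + a * (T * (c + (a + b))))
      ≤⟨ +-monoʳ-≤ (b * P) bD+aR≤ ⟩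
    b * P + (P + T * a * suc b)
      ≡⟨ solve (List ℕ ∋ T ∷ a ∷ b ∷ P ∷ []) ⟩
    suc b * (P + T * a)
      ≤⟨ *-monoʳ-≤ (suc b) (+-monoʳ-≤ P (*-monoʳ-≤ T (m≤m+n a b))) ⟩
    suc b * (P + T * (a + b))
      <⟨ *-monoʳ-< (suc b) below ⟩
    suc b * ((a + b) * (T * (c + (a + b)))) ∎)

insert-usuallyAvgIsolated :
  ∀ {n t} (G : Fin (suc t) → SimpleGraph n) {c δ : ℕ} {C C' Y : Subset n} {x : Fin n} →
  IsClique (interAdj G) C → IsMinDegree (interAdj G) C δ → C' ⊆ C → x ∈ C → x ∉ C' →
  ∣ C' ∩ Y ∣ + c ≤ suc δ → (∀ {w} → w ∈ C' ∩ ∁ Y → totDeg G x ≤ totDeg G w) →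
  UsuallyAvgIsolated c G C' zero (fromℕ t) → UsuallyAvgIsolated c G (C' ∪ ⁅ x ⁆) zero (fromℕ t)
insert-usuallyAvgIsolated {t = t} G {c} {δ} {C} {C'} {Y} {x}
                          C-clique δ-min C'⊆C x∈C x∉C' small lowest C'-isolated =
  Equivalence.from (usuallyAvgIsolated⇔DegreeSumBelow G c (layer-clique C'∪x⊆C))
    (subst₂ (DegreeSumBelow (suc t) c) (sym (sumOver-∪-⁅⁆ C' (totDeg G) x∉C')) (sym ∣C'∪x∣≡)
      (degreeSumBelow-insert {suc t} {c} {δ} {∣ C' ∩ Y ∣} {∣ C' ∩ ∁ Y ∣} {P} {totDeg G x}
        C'-below P≥ small))
  where
  P : ℕ
  P = sumOver C' (totDeg G)
  layer-clique : ∀ {X} → X ⊆ C → ∀ i → IsClique (adj (G i)) X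
  layer-clique X⊆C i = clique-⊆ (interAdj-clique⇒ G C-clique i) X⊆C
  C'∪x⊆C : C' ∪ ⁅ x ⁆ ⊆ C
  C'∪x⊆C w∈ = [ C'⊆C , (λ w∈⁅x⁆ → subst (_∈ C) (sym (x∈⁅y⁆⇒x≡y x w∈⁅x⁆)) x∈C) ] (x∈p∪q⁻ C' ⁅ x ⁆ w∈)
  C'-below : DegreeSumBelow (suc t) c P (∣ C' ∩ Y ∣ + ∣ C' ∩ ∁ Y ∣)
  C'-below = subst (DegreeSumBelow (suc t) c P) (∣p∣≡∣p∩q∣+∣p∩∁q∣ C' Y)
    (Equivalence.to (usuallyAvgIsolated⇔DegreeSumBelow G c (layer-clique C'⊆C)) C'-isolated)
  ∣C'∪x∣≡ : ∣ C' ∪ ⁅ x ⁆ ∣ ≡ suc (∣ C' ∩ Y ∣ + ∣ C' ∩ ∁ Y ∣)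
  ∣C'∪x∣≡ = trans (x∉p⇒∣p∪⁅x⁆∣≡1+∣p∣ C' x∉C') (cong suc (∣p∣≡∣p∩q∣+∣p∩∁q∣ C' Y))
  P≥ : ∣ C' ∩ Y ∣ * (suc t * δ) + ∣ C' ∩ ∁ Y ∣ * totDeg G x ≤ P
  P≥ = sumOver≥-∩-∁ C' Y (minDegree⇒t*δ≤totDeg G δ-min ∘ C'⊆C ∘ proj₁ ∘ x∈p∩q⁻ C' Y) lowest

lemma4 : ∀ {n t} (G : Fin (suc t) → SimpleGraph n) (c : ℕ) → 0 < c →
  (C : Subset n) → IsClique (interAdj G) C →
  (C' : Subset n) → C' ⊆ C → VertexMaximal c G C' zero (fromℕ t) →
  (δ : ℕ) → IsMinDegree (interAdj G) C δ →
  (C~ : Subset n) → C~ ⊆ C → ∣ C~ ∣ ≡ δ + 2 ∸ c →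
  (∀ v w → v ∈ C~ → w ∈ C → w ∉ C~ → totDeg G v ≤ totDeg G w) →
  C~ ⊆ C'
lemma4 G c _ C C-clique C' C'⊆C (C'-isolated , C'-maximal) δ δ-min C~ C~⊆C ∣C~∣≡ C~-lowest {x} x∈C~
  with x ∈? C'
... | yes x∈C' = x∈C'
... | no  x∉C' = contradiction
        (insert-usuallyAvgIsolated G C-clique δ-min C'⊆C (C~⊆C x∈C~) x∉C' small lowest C'-isolated)
        (C'-maximal (C' ∪ ⁅ x ⁆) (p⊆p∪q ⁅ x ⁆ , x , q⊆p∪q C' ⁅ x ⁆ (x∈⁅x⁆ x) , x∉C'))
  where
  C'∩C~⊂C~ : C' ∩ C~ ⊂ C~
  C'∩C~⊂C~ = p∩q⊆q C' C~ , x , x∈C~ , x∉C' ∘ proj₁ ∘ x∈p∩q⁻ C' C~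
  small : ∣ C' ∩ C~ ∣ + c ≤ suc δ
  small = ≤-pred (subst (∣ C' ∩ C~ ∣ + c <_) (+-comm δ 2)
            (m<n∸o⇒m+o<n {o = c} (subst (∣ C' ∩ C~ ∣ <_) ∣C~∣≡ (p⊂q⇒∣p∣<∣q∣ C'∩C~⊂C~))))
  lowest : ∀ {w} → w ∈ C' ∩ ∁ C~ → totDeg G x ≤ totDeg G w
  lowest {w} w∈ with x∈p∩q⁻ C' (∁ C~) w∈
  ... | w∈C' , w∈∁C~ = C~-lowest x w x∈C~ (C'⊆C w∈C') (x∈∁p⇒x∉p w∈∁C~)
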